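{- Let $q$ be a prime power and $t\ge1$ an integer. Let $\Omega$ be a $(t-2)$-dimensional subspace of a projective space over $\mathbb{F}_q$, let $\Gamma$ be a plane disjoint from $\Omega$, let $\bar B$ be a non-trivial minimal blocking set (with respect to lines) in $\Gamma$, and let $K=\bigcup_{\bar P\in\bar B}\langle\bar P,\Omega\rangle$ be the cone with vertex $\Omega$ and base $\bar B$. If $P$ is a point of $K$ not contained in $\Omega$, then $P$ lies on exactly $(q^{t-1}-1)/(q-1)$ lines contained in $K$.
   Context: A blocking set with respect to lines in a plane meets every line; it is minimal if no proper subset is one; it is non-trivial if it contains no line. -}

module Defs where

open import Level using (_⊔_)
open import Algebra.Bundles using (CommutativeRing)
open import Data.Nat using (ℕ; zero; suc; _^_)
open import Data.Nat.Primality using (Prime)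
open import Data.Fin using (Fin; zero; suc)
open import Data.List using (List)
open import Data.List.Relation.Unary.All using (All)
open import Data.List.Relation.Unary.Any using (Any)
open import Data.Product using (_×_; ∃; ∃₂; Σ)
open import Data.Vec.Functional using (_∷_)
open import Function.Base using (_∘_)
open import Function.Bundles using (Bijection)
open import Relation.Nullary using (¬_)
open import Relation.Binary using (Decidable)
import Relation.Binary.PropositionalEquality as ≡

IsPrimePower : ℕ → Set
IsPrimePower q = ∃₂ λ p k → Prime p × q ≡.≡ p ^ suc k

record IsFiniteField {c ℓ} (F : CommutativeRing c ℓ) (q : ℕ) : Set (c ⊔ ℓ) where
  open CommutativeRing F using (Carrier; _≈_; _*_; 0#; 1#; setoid)
  field
    _≟_     : Decidable _≈_
    0≉1     : ¬ (0# ≈ 1#)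
    inverse : ∀ x → ¬ (x ≈ 0#) → ∃ λ y → x * y ≈ 1#
    card    : Bijection setoid (≡.setoid (Fin q))

-- Projective geometry PG(m-1, F) modelled on the vector space F^m.
-- Projective subspaces are spans of finite families of vectors; points are
-- nonzero vectors (up to nonzero scalars, which never matters below since
-- every notion is stated via spans).
module Geometry {c ℓ} (F : CommutativeRing c ℓ) where
  open CommutativeRing F using (Carrier; _≈_; _+_; _*_; 0#)

  Vec : ℕ → Set c
  Vec m = Fin m → Carrier

  _≋_ : ∀ {m} → Vec m → Vec m → Set ℓ
  u ≋ v = ∀ i → u i ≈ v i

  0v : ∀ {m} → Vec m
  0v _ = 0#

  _+v_ : ∀ {m} → Vec m → Vec m → Vec m
  (u +v v) i = u i + v i

  _·v_ : ∀ {m} → Carrier → Vec m → Vec m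
  (a ·v v) i = a * v i

  lincomb : ∀ {m k} → (Fin k → Carrier) → (Fin k → Vec m) → Vec m
  lincomb {k = zero}  cs gs = 0v
  lincomb {k = suc k} cs gs = (cs zero ·v gs zero) +v lincomb (cs ∘ suc) (gs ∘ suc)

  InSpan : ∀ {m k} → (Fin k → Vec m) → Vec m → Set (c ⊔ ℓ)
  InSpan gs v = ∃ λ cs → v ≋ lincomb cs gs

  Independent : ∀ {m k} → (Fin k → Vec m) → Set (c ⊔ ℓ)
  Independent gs = ∀ cs → lincomb cs gs ≋ 0v → ∀ i → cs i ≈ 0#

  NonZeroV : ∀ {m} → Vec m → Set ℓ
  NonZeroV v = ¬ (v ≋ 0v)

  PointIn : ∀ {m k} → (Fin k → Vec m) → Vec m → Set (c ⊔ ℓ)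
  PointIn gs v = NonZeroV v × InSpan gs v

  Disjoint : ∀ {m k l} → (Fin k → Vec m) → (Fin l → Vec m) → Set (c ⊔ ℓ)
  Disjoint gs hs = ∀ v → InSpan gs v → InSpan hs v → v ≋ 0v

  Line : ℕ → Set c
  Line m = Fin 2 → Vec m

  IsLine : ∀ {m} → Line m → Set (c ⊔ ℓ)
  IsLine L = Independent L

  SameLine : ∀ {m} → Line m → Line m → Set (c ⊔ ℓ)
  SameLine L L' = ∀ v → (InSpan L v → InSpan L' v) × (InSpan L' v → InSpan L v)

  LineIn : ∀ {m k} → (Fin k → Vec m) → Line m → Set (c ⊔ ℓ)
  LineIn gs L = IsLine L × (∀ i → InSpan gs (L i))

  -- a finite set of points, given by a list of representative vectors
  PointSet : ℕ → Set c
  PointSet m = List (Vec m)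

  _∈P_ : ∀ {m} → Vec m → PointSet m → Set (c ⊔ ℓ)
  v ∈P B = NonZeroV v × Any (λ w → ∃ λ a → v ≋ (a ·v w)) B

  PointSetOf : ∀ {m} → (Fin 3 → Vec m) → PointSet m → Set (c ⊔ ℓ)
  PointSetOf Γ B = All (PointIn Γ) B

  Blocking : ∀ {m} → (Fin 3 → Vec m) → PointSet m → Set (c ⊔ ℓ)
  Blocking Γ B = ∀ L → LineIn Γ L → ∃ λ v → InSpan L v × v ∈P B

  Minimal : ∀ {m} → (Fin 3 → Vec m) → PointSet m → Set (c ⊔ ℓ)
  Minimal Γ B = ∀ B' → PointSetOf Γ B' → (∀ v → v ∈P B' → v ∈P B) →
                Blocking Γ B' → ¬ (∃ λ v → v ∈P B × ¬ (v ∈P B'))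

  NonTrivial : ∀ {m} → (Fin 3 → Vec m) → PointSet m → Set (c ⊔ ℓ)
  NonTrivial Γ B = ∀ L → LineIn Γ L → ¬ (∀ v → PointIn L v → v ∈P B)

  InCone : ∀ {m k} → (Fin k → Vec m) → PointSet m → Vec m → Set (c ⊔ ℓ)
  InCone Ω B v = NonZeroV v × ∃ λ w → w ∈P B × InSpan (w ∷ Ω) v

  LineInCone : ∀ {m k} → (Fin k → Vec m) → PointSet m → Line m → Set (c ⊔ ℓ)
  LineInCone Ω B L = IsLine L × (∀ v → PointIn L v → InCone Ω B v)

module Submission where

-- The lines of K through P are exactly the joins ⟨P, ω⟩ with ω a point of ⟨Ω⟩:
--   * each join lies in K, since P ∈ ⟨w, Ω⟩ for some w ∈ B (join-in-cone);
--   * conversely a line L ⊆ K meets ⟨Ω⟩: projecting L from ⟨Ω⟩ onto Γ gives either a line of Γ,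
--     which would lie in B (projection-in-base) and so contradict non-triviality, or a degenerate
--     image, and then a point of L is congruent to 0 modulo ⟨Ω⟩ (line-meets-vertex);
--   * a line through P meeting ⟨Ω⟩ in ω is ⟨P, ω⟩ (line-spanned-by, via the exchange lemma), and
--     distinct points of ⟨Ω⟩ give distinct joins (same-line⇒proportional).
-- Hence the lines are indexed by the points of PG(t−2, q), of which there are (q^(t−1) − 1)/(q − 1).

open import Defs
open import Algebra.Bundles using (CommutativeRing)
open import Data.Empty using (⊥-elim)
open import Data.Fin using (Fin; zero; suc)
open import Data.Fin.Properties using (all?)
open import Data.List using (List; length)
import Data.List as List
import Data.List.Properties as Listₚ
open import Data.List.Relation.Unary.All using (All)
import Data.List.Relation.Unary.All as All
import Data.List.Relation.Unary.All.Properties as Allₚ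
open import Data.List.Relation.Unary.Any using (Any; here)
import Data.List.Relation.Unary.Any as Any
import Data.List.Relation.Unary.Any.Properties as Anyₚ
open import Data.List.Relation.Unary.AllPairs using (AllPairs)
import Data.List.Relation.Unary.AllPairs as AllPairs
import Data.List.Relation.Unary.AllPairs.Properties as AllPairsₚ
import Data.List.Relation.Unary.Unique.Setoid.Properties as Uniqueₚ
open import Data.Nat using (ℕ; zero; suc)
import Data.Nat as ℕ
import Data.Nat.Properties as ℕₚ
open import Data.Product using (_×_; ∃; _,_; proj₁; proj₂; swap)
open import Data.Sum using (_⊎_; inj₁; inj₂)
open import Data.Vec.Functional using (_∷_; [])
open import Function.Base using (_∘_)
open import Function.Bundles using (Bijection; Inverse)
open import Function.Properties.Bijection using (Bijection⇒Inverse)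
open import Level using (_⊔_)
open import Relation.Binary using (Decidable)
open import Relation.Binary.PropositionalEquality using (_≡_)
import Relation.Binary.PropositionalEquality as ≡
open import Relation.Nullary using (¬_; Dec; yes; no; ¬?)
open import Relation.Nullary.Decidable using (_×-dec_; decidable-stable)

length-cartesianProductWith : ∀ {a b c} {A : Set a} {B : Set b} {C : Set c} (f : A → B → C) xs ys →
  length (List.cartesianProductWith f xs ys) ≡ length xs ℕ.* length ys
length-cartesianProductWith f List.[]         ys = ≡.refl
length-cartesianProductWith f (x List.∷ xs) ys = begin
  length (List.map (f x) ys List.++ List.cartesianProductWith f xs ys)
    ≡⟨ Listₚ.length-++ (List.map (f x) ys) ⟩
  length (List.map (f x) ys) ℕ.+ length (List.cartesianProductWith f xs ys)
    ≡⟨ ≡.cong₂ ℕ._+_ (Listₚ.length-map (f x) ys) (length-cartesianProductWith f xs ys) ⟩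
  length ys ℕ.+ length xs ℕ.* length ys
    ∎
  where open ≡.≡-Reasoning

geometric-step : ∀ q n a → a ℕ.* (q ℕ.∸ 1) ≡ q ℕ.^ n ℕ.∸ 1 →
  (q ℕ.^ n ℕ.+ a) ℕ.* (q ℕ.∸ 1) ≡ q ℕ.^ suc n ℕ.∸ 1
geometric-step zero    n a _   = ℕₚ.*-zeroʳ (0 ℕ.^ n ℕ.+ a)
geometric-step (suc r) n a hyp = step (suc r ℕ.^ n) (ℕₚ.m^n>0 (suc r) n) hyp
  where
  open ≡.≡-Reasoning
  step : ∀ x → 0 ℕ.< x → a ℕ.* r ≡ x ℕ.∸ 1 → (x ℕ.+ a) ℕ.* r ≡ suc r ℕ.* x ℕ.∸ 1
  step (suc s) _ ar≡s = begin
    (suc s ℕ.+ a) ℕ.* r        ≡⟨ ℕₚ.*-distribʳ-+ r (suc s) a ⟩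
    suc s ℕ.* r ℕ.+ a ℕ.* r    ≡⟨ ≡.cong (suc s ℕ.* r ℕ.+_) ar≡s ⟩
    suc s ℕ.* r ℕ.+ s          ≡⟨ ℕₚ.+-comm (suc s ℕ.* r) s ⟩
    s ℕ.+ suc s ℕ.* r          ≡⟨ ≡.cong (s ℕ.+_) (ℕₚ.*-comm (suc s) r) ⟩
    s ℕ.+ r ℕ.* suc s          ∎

module LinearAlgebra {c ℓ} (F : CommutativeRing c ℓ) where
  open CommutativeRing F hiding (zero)
  open Geometry F
  open import Algebra.Properties.Ring ring using (-1*x≈-x; -0#≈0#; -‿distribʳ-*; -‿distribˡ-*)
  open import Algebra.Properties.AbelianGroup +-abelianGroup using (⁻¹-anti-homo‿-; ⁻¹-∙-comm; xyx⁻¹≈y)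
  open import Algebra.Properties.Group +-group using (//-rightDividesˡ; //-rightDividesʳ; x∙y⁻¹≈ε⇒x≈y)
  open import Algebra.Properties.CommutativeSemigroup +-commutativeSemigroup using (interchange; x∙yz≈y∙xz)
  open import Data.Vec.Functional.Relation.Binary.Equality.Setoid setoid
    using (≋-refl; ≋-sym; ≋-trans; ≋-setoid)
  open import Relation.Binary.Reasoning.Setoid setoid

  _-v_ : ∀ {m} → Vec m → Vec m → Vec m
  (u -v v) j = u j - v j

  lincomb-cong : ∀ {m k} {cs ds : Fin k → Carrier} (gs : Fin k → Vec m) →
    (∀ i → cs i ≈ ds i) → lincomb cs gs ≋ lincomb ds gs
  lincomb-cong {k = zero} gs eq j = refl
  lincomb-cong {k = suc k} gs eq j = +-cong (*-cong (eq zero) refl) (lincomb-cong (gs ∘ suc) (eq ∘ suc) j)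

  lincomb-zero : ∀ {m k} {cs : Fin k → Carrier} (gs : Fin k → Vec m) →
    (∀ i → cs i ≈ 0#) → lincomb cs gs ≋ 0v
  lincomb-zero {k = zero} gs eq j = refl
  lincomb-zero {k = suc k} gs eq j =
    trans (+-cong (trans (*-cong (eq zero) refl) (zeroˡ _)) (lincomb-zero (gs ∘ suc) (eq ∘ suc) j))
          (+-identityʳ 0#)

  lincomb-+ : ∀ {m k} (cs ds : Fin k → Carrier) (gs : Fin k → Vec m) →
    lincomb (λ i → cs i + ds i) gs ≋ (lincomb cs gs +v lincomb ds gs)
  lincomb-+ {k = zero} cs ds gs j = sym (+-identityʳ 0#)
  lincomb-+ {k = suc k} cs ds gs j =
    trans (+-cong (distribʳ (gs zero j) (cs zero) (ds zero)) (lincomb-+ (cs ∘ suc) (ds ∘ suc) (gs ∘ suc) j))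
          (interchange _ _ _ _)

  lincomb-· : ∀ {m k} (a : Carrier) (cs : Fin k → Carrier) (gs : Fin k → Vec m) →
    lincomb (λ i → a * cs i) gs ≋ (a ·v lincomb cs gs)
  lincomb-· {k = zero} a cs gs j = sym (zeroʳ a)
  lincomb-· {k = suc k} a cs gs j =
    trans (+-cong (*-assoc a (cs zero) (gs zero j)) (lincomb-· a (cs ∘ suc) (gs ∘ suc) j))
          (sym (distribˡ a _ _))

  unit : ∀ {k} → Fin k → Fin k → Carrier
  unit zero    zero    = 1#
  unit zero    (suc j) = 0#
  unit (suc i) zero    = 0#
  unit (suc i) (suc j) = unit i j

  unit-diagonal : ∀ {k} (i : Fin k) → unit i i ≈ 1#
  unit-diagonal zero    = refl
  unit-diagonal (suc i) = unit-diagonal i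

  lincomb-unit : ∀ {m k} (gs : Fin k → Vec m) i → lincomb (unit i) gs ≋ gs i
  lincomb-unit gs zero j =
    trans (+-cong (*-identityˡ _) (lincomb-zero (gs ∘ suc) (λ _ → refl) j)) (+-identityʳ _)
  lincomb-unit gs (suc i) j =
    trans (+-cong (zeroˡ _) (lincomb-unit (gs ∘ suc) i j)) (+-identityˡ _)

  span-resp : ∀ {m k} {gs : Fin k → Vec m} {u v} → u ≋ v → InSpan gs u → InSpan gs v
  span-resp u≋v (cs , u≋) = cs , ≋-trans (≋-sym u≋v) u≋

  span-0 : ∀ {m k} {gs : Fin k → Vec m} → InSpan gs 0v
  span-0 {gs = gs} = (λ _ → 0#) , ≋-sym (lincomb-zero gs (λ _ → refl))

  span-+ : ∀ {m k} {gs : Fin k → Vec m} {u v} → InSpan gs u → InSpan gs v → InSpan gs (u +v v)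
  span-+ {gs = gs} (cs , u≋) (ds , v≋) =
    (λ i → cs i + ds i) , ≋-trans (λ j → +-cong (u≋ j) (v≋ j)) (≋-sym (lincomb-+ cs ds gs))

  span-· : ∀ {m k} {gs : Fin k → Vec m} a {u} → InSpan gs u → InSpan gs (a ·v u)
  span-· {gs = gs} a (cs , u≋) =
    (λ i → a * cs i) , ≋-trans (λ j → *-cong refl (u≋ j)) (≋-sym (lincomb-· a cs gs))

  span-- : ∀ {m k} {gs : Fin k → Vec m} {u v} → InSpan gs u → InSpan gs v → InSpan gs (u -v v)
  span-- u∈ v∈ = span-+ u∈ (span-resp (λ j → -1*x≈-x _) (span-· (- 1#) v∈))

  span-gen : ∀ {m k} (gs : Fin k → Vec m) i → InSpan gs (gs i)
  span-gen gs i = unit i , ≋-sym (lincomb-unit gs i)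

  lincomb-in-span : ∀ {m k l} {gs : Fin k → Vec m} {hs : Fin l → Vec m} →
    (∀ i → InSpan hs (gs i)) → ∀ cs → InSpan hs (lincomb cs gs)
  lincomb-in-span {k = zero}  _     cs = span-0
  lincomb-in-span {k = suc k} gs⊆hs cs =
    span-+ (span-· (cs zero) (gs⊆hs zero)) (lincomb-in-span (gs⊆hs ∘ suc) (cs ∘ suc))

  span-⊆ : ∀ {m k l} {gs : Fin k → Vec m} {hs : Fin l → Vec m} →
    (∀ i → InSpan hs (gs i)) → ∀ {v} → InSpan gs v → InSpan hs v
  span-⊆ gs⊆hs (cs , v≋) = span-resp (≋-sym v≋) (lincomb-in-span gs⊆hs cs)

  span-tail : ∀ {m k} {gs : Fin k → Vec m} w {v} → InSpan gs v → InSpan (w ∷ gs) v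
  span-tail {gs = gs} w = span-⊆ {hs = w ∷ gs} (λ i → span-gen (w ∷ gs) (suc i))

  span-cancel : ∀ {m k} {gs : Fin k → Vec m} {u w} → InSpan gs (u +v w) → InSpan gs w → InSpan gs u
  span-cancel u+w∈ w∈ = span-resp (λ j → //-rightDividesʳ _ _) (span-- u+w∈ w∈)

  _≡[_]_ : ∀ {m k} → Vec m → (Fin k → Vec m) → Vec m → Set (c ⊔ ℓ)
  x ≡[ S ] y = InSpan S (x -v y)

  ≡-refl : ∀ {m k} {S : Fin k → Vec m} {x} → x ≡[ S ] x
  ≡-refl = span-resp (λ j → sym (-‿inverseʳ _)) span-0

  ≡-sym : ∀ {m k} {S : Fin k → Vec m} {x y} → x ≡[ S ] y → y ≡[ S ] x
  ≡-sym x≡y = span-resp (λ j → trans (+-identityˡ _) (⁻¹-anti-homo‿- _ _)) (span-- span-0 x≡y)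

  ≡-trans : ∀ {m k} {S : Fin k → Vec m} {x y z} → x ≡[ S ] y → y ≡[ S ] z → x ≡[ S ] z
  ≡-trans x≡y y≡z = span-resp (λ j → trans (sym (+-assoc _ _ _)) (+-cong (//-rightDividesˡ _ _) refl))
                              (span-+ x≡y y≡z)

  ≡-resp : ∀ {m k} {S : Fin k → Vec m} {x y y′} → x ≡[ S ] y → y ≋ y′ → x ≡[ S ] y′
  ≡-resp x≡y y≋y′ = span-resp (λ j → +-cong refl (-‿cong (y≋y′ j))) x≡y

  ≡-0 : ∀ {m k} {S : Fin k → Vec m} {x y} → x ≡[ S ] y → y ≋ 0v → InSpan S x
  ≡-0 x≡y y≋0 = span-resp (λ j → trans (+-cong refl (trans (-‿cong (y≋0 j)) -0#≈0#)) (+-identityʳ _)) x≡y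

  ≡-lincomb : ∀ {m k l} {S : Fin l → Vec m} {gs hs : Fin k → Vec m} →
    (∀ i → gs i ≡[ S ] hs i) → ∀ cs → lincomb cs gs ≡[ S ] lincomb cs hs
  ≡-lincomb {k = zero}  gs≡hs cs = ≡-refl
  ≡-lincomb {k = suc k} gs≡hs cs =
    span-resp (λ j → sym (difference-of-sums _ _ _ _))
      (span-+ (span-resp (λ j → sym (difference-of-multiples _ _ _)) (span-· (cs zero) (gs≡hs zero)))
              (≡-lincomb (gs≡hs ∘ suc) (cs ∘ suc)))
    where
    difference-of-sums : ∀ x x′ y y′ → (x + x′) - (y + y′) ≈ (x - y) + (x′ - y′)
    difference-of-sums x x′ y y′ =
      trans (+-cong refl (sym (⁻¹-∙-comm y y′))) (interchange x x′ (- y) (- y′))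
    difference-of-multiples : ∀ a x y → a * x - a * y ≈ a * (x - y)
    difference-of-multiples a x y = trans (+-cong refl (-‿distribʳ-* a y)) (sym (distribˡ a x (- y)))

  ≡-disjoint : ∀ {m k l} {S : Fin k → Vec m} {T : Fin l → Vec m} {x y} →
    Disjoint S T → x ≡[ S ] y → InSpan T x → InSpan T y → x ≋ y
  ≡-disjoint disj x≡y x∈T y∈T j = x∙y⁻¹≈ε⇒x≈y _ _ (disj _ x≡y (span-- x∈T y∈T) j)

  Proportional : ∀ {n} → Vec n → Vec n → Set (c ⊔ ℓ)
  Proportional u v = ∃ λ b → v ≋ (b ·v u)

  module DiscreteField (_≟_ : Decidable _≈_) (0≉1 : ¬ 0# ≈ 1#)
    (inverse : ∀ x → ¬ x ≈ 0# → ∃ λ y → x * y ≈ 1#) where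

    1≉0 : ¬ 1# ≈ 0#
    1≉0 1≈0 = 0≉1 (sym 1≈0)

    span-unscale : ∀ {m k} {gs : Fin k → Vec m} {a u} → ¬ a ≈ 0# → InSpan gs (a ·v u) → InSpan gs u
    span-unscale {a = a} {u} a≉0 au∈ with inverse a a≉0
    ... | a⁻¹ , aa⁻¹≈1 = span-resp a⁻¹[au]≈u (span-· a⁻¹ au∈)
      where
      a⁻¹[au]≈u : (a⁻¹ ·v (a ·v u)) ≋ u
      a⁻¹[au]≈u j = begin
        a⁻¹ * (a * u j) ≈⟨ *-assoc a⁻¹ a (u j) ⟨
        (a⁻¹ * a) * u j ≈⟨ *-cong (trans (*-comm a⁻¹ a) aa⁻¹≈1) refl ⟩
        1# * u j        ≈⟨ *-identityˡ (u j) ⟩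
        u j             ∎

    independent⇒nonzero : ∀ {m k} {gs : Fin k → Vec m} → Independent gs → ∀ i → NonZeroV (gs i)
    independent⇒nonzero {gs = gs} ind i gs-i≋0 =
      1≉0 (trans (sym (unit-diagonal i)) (ind (unit i) (≋-trans (lincomb-unit gs i) gs-i≋0) i))

    off-subspace-coefficient : ∀ {m k} {S : Fin k → Vec m} {P w} a → ¬ InSpan S P →
      InSpan S w → InSpan S ((a ·v P) +v w) → a ≈ 0#
    off-subspace-coefficient a P∉S w∈S aP+w∈S with a ≟ 0#
    ... | yes a≈0 = a≈0
    ... | no  a≉0 = ⊥-elim (P∉S (span-unscale a≉0 (span-cancel aP+w∈S w∈S)))

    independent-extend : ∀ {m k} {gs : Fin k → Vec m} {P} → Independent gs → ¬ InSpan gs P →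
      Independent (P ∷ gs)
    independent-extend {gs = gs} {P} ind P∉ cs comb≋0 = λ where
        zero    → c₀≈0
        (suc i) → ind (cs ∘ suc) tail≋0 i
      where
      c₀≈0 : cs zero ≈ 0#
      c₀≈0 = off-subspace-coefficient (cs zero) P∉ (cs ∘ suc , ≋-refl) (span-resp (≋-sym comb≋0) span-0)
      tail≋0 : lincomb (cs ∘ suc) gs ≋ 0v
      tail≋0 j = begin
        lincomb (cs ∘ suc) gs j                 ≈⟨ +-identityˡ _ ⟨
        0# + lincomb (cs ∘ suc) gs j            ≈⟨ +-cong (trans (*-cong c₀≈0 refl) (zeroˡ (P j))) refl ⟨
        cs zero * P j + lincomb (cs ∘ suc) gs j ≈⟨ comb≋0 j ⟩
        0#                                      ∎

    independent-unique : ∀ {m k} {gs : Fin k → Vec m} → Independent gs →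
      ∀ cs ds → lincomb cs gs ≋ lincomb ds gs → ∀ i → cs i ≈ ds i
    independent-unique {gs = gs} ind cs ds same i = x∙y⁻¹≈ε⇒x≈y _ _ (ind (λ i → cs i - ds i) difference≋0 i)
      where
      difference≋0 : lincomb (λ i → cs i - ds i) gs ≋ 0v
      difference≋0 j = begin
        lincomb (λ i → cs i - ds i) gs j
          ≈⟨ lincomb-+ cs (λ i → - ds i) gs j ⟩
        lincomb cs gs j + lincomb (λ i → - ds i) gs j
          ≈⟨ +-cong refl (lincomb-cong gs (λ i → sym (-1*x≈-x (ds i))) j) ⟩
        lincomb cs gs j + lincomb (λ i → - 1# * ds i) gs j
          ≈⟨ +-cong refl (lincomb-· (- 1#) ds gs j) ⟩
        lincomb cs gs j + - 1# * lincomb ds gs j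
          ≈⟨ +-cong (same j) (-1*x≈-x _) ⟩
        lincomb ds gs j - lincomb ds gs j
          ≈⟨ -‿inverseʳ _ ⟩
        0#
          ∎

    exchange : ∀ {m k} {u X} {vs : Fin k → Vec m} cs → X ≋ lincomb cs (u ∷ vs) → ¬ cs zero ≈ 0# →
      InSpan (X ∷ vs) u
    exchange {u = u} {X} {vs} cs X≋ c₀≉0 =
      span-unscale {gs = X ∷ vs} c₀≉0
        (span-cancel {gs = X ∷ vs} (span-resp {gs = X ∷ vs} X≋ (span-gen (X ∷ vs) zero))
                                   (span-tail X (cs ∘ suc , ≋-refl)))

    lincomb-swap : ∀ {m} a b (u v : Vec m) →
      lincomb (a ∷ b ∷ []) (u ∷ v ∷ []) ≋ lincomb (b ∷ a ∷ []) (v ∷ u ∷ [])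
    lincomb-swap a b u v j = x∙yz≈y∙xz _ _ _

    span-swap : ∀ {m} {u v z : Vec m} → InSpan (u ∷ v ∷ []) z → InSpan (v ∷ u ∷ []) z
    span-swap {u = u} {v} = span-⊆ {gs = u ∷ v ∷ []} {hs = v ∷ u ∷ []} λ where
      zero       → span-gen (v ∷ u ∷ []) (suc zero)
      (suc zero) → span-gen (v ∷ u ∷ []) zero

    line-not-multiple : ∀ {m} {X Y : Vec m} e → IsLine (X ∷ Y ∷ []) → ¬ Y ≋ (e ·v X)
    line-not-multiple {X = X} {Y} e ind Y≋eX = 1≉0 (ind (- e ∷ 1# ∷ []) combination≋0 (suc zero))
      where
      combination≋0 : lincomb (- e ∷ 1# ∷ []) (X ∷ Y ∷ []) ≋ 0v
      combination≋0 j = begin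
        - e * X j + (1# * Y j + 0#) ≈⟨ +-cong refl (trans (+-identityʳ _) (*-identityˡ _)) ⟩
        - e * X j + Y j              ≈⟨ +-cong (sym (-‿distribˡ-* e (X j))) (Y≋eX j) ⟩
        - (e * X j) + e * X j        ≈⟨ -‿inverseˡ _ ⟩
        0#                           ∎

    -- Two independent points X, Y of ⟨u, v⟩ span it, when u occurs in X with a nonzero coefficient:
    -- exchange u for X, then v for Y.
    spanned-by-pair₀ : ∀ {m} {u v X Y : Vec m} a b → IsLine (X ∷ Y ∷ []) →
      X ≋ lincomb (a ∷ b ∷ []) (u ∷ v ∷ []) → ¬ a ≈ 0# → InSpan (u ∷ v ∷ []) Y →
      InSpan (X ∷ Y ∷ []) u × InSpan (X ∷ Y ∷ []) v
    spanned-by-pair₀ {u = u} {v} {X} {Y} a b ind X≋ a≉0 Y∈⟨u,v⟩ = u∈⟨X,Y⟩ , v∈⟨X,Y⟩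
      where
      u∈⟨X,v⟩ : InSpan (X ∷ v ∷ []) u
      u∈⟨X,v⟩ = exchange {vs = v ∷ []} (a ∷ b ∷ []) X≋ a≉0
      Y∈⟨X,v⟩ : InSpan (X ∷ v ∷ []) Y
      Y∈⟨X,v⟩ = span-⊆ {gs = u ∷ v ∷ []} {hs = X ∷ v ∷ []}
                  (λ { zero → u∈⟨X,v⟩ ; (suc zero) → span-gen (X ∷ v ∷ []) (suc zero) }) Y∈⟨u,v⟩
      e f : Carrier
      e = proj₁ Y∈⟨X,v⟩ zero
      f = proj₁ Y∈⟨X,v⟩ (suc zero)
      Y≋eX+fv : Y ≋ lincomb (e ∷ f ∷ []) (X ∷ v ∷ [])
      Y≋eX+fv = proj₂ Y∈⟨X,v⟩
      f≉0 : ¬ f ≈ 0#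
      f≉0 f≈0 = line-not-multiple {X = X} {Y} e ind λ j → begin
        Y j                        ≈⟨ Y≋eX+fv j ⟩
        e * X j + (f * v j + 0#)   ≈⟨ +-cong refl (trans (+-identityʳ _)
                                                         (trans (*-cong f≈0 refl) (zeroˡ _))) ⟩
        e * X j + 0#               ≈⟨ +-identityʳ _ ⟩
        e * X j                    ∎
      v∈⟨X,Y⟩ : InSpan (X ∷ Y ∷ []) v
      v∈⟨X,Y⟩ = span-swap {u = Y} {X}
        (exchange {vs = X ∷ []} (f ∷ e ∷ []) (≋-trans Y≋eX+fv (lincomb-swap e f X v)) f≉0)
      u∈⟨X,Y⟩ : InSpan (X ∷ Y ∷ []) u
      u∈⟨X,Y⟩ = span-⊆ {gs = X ∷ v ∷ []} {hs = X ∷ Y ∷ []}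
                  (λ { zero → span-gen (X ∷ Y ∷ []) zero ; (suc zero) → v∈⟨X,Y⟩ }) u∈⟨X,v⟩

    line-spanned-by : ∀ {m} (L : Line m) {X Y} → IsLine (X ∷ Y ∷ []) →
      InSpan L X → InSpan L Y → SameLine L (X ∷ Y ∷ [])
    line-spanned-by L {X} {Y} ind (xs , X≋) Y∈L z =
      span-⊆ {gs = L} {hs = X ∷ Y ∷ []} L⊆⟨X,Y⟩ , span-⊆ {gs = X ∷ Y ∷ []} {hs = L} ⟨X,Y⟩⊆L
      where
      a b : Carrier
      a = xs zero
      b = xs (suc zero)
      X≋aL₀+bL₁ : X ≋ lincomb (a ∷ b ∷ []) (L zero ∷ L (suc zero) ∷ [])
      X≋aL₀+bL₁ = X≋
      L-in-⟨X,Y⟩ : InSpan (X ∷ Y ∷ []) (L zero) × InSpan (X ∷ Y ∷ []) (L (suc zero))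
      L-in-⟨X,Y⟩ with a ≟ 0#
      ... | no a≉0  = spanned-by-pair₀ a b ind X≋aL₀+bL₁ a≉0 Y∈L
      ... | yes a≈0 = swap
                        (spanned-by-pair₀ b a ind (≋-trans X≋aL₀+bL₁ (lincomb-swap a b _ _)) b≉0
                                          (span-swap {u = L zero} {L (suc zero)} Y∈L))
        where
        b≉0 : ¬ b ≈ 0#
        b≉0 b≈0 = independent⇒nonzero {gs = X ∷ Y ∷ []} ind zero
          (≋-trans X≋aL₀+bL₁ (lincomb-zero {cs = a ∷ b ∷ []} (L zero ∷ L (suc zero) ∷ [])
                                          λ { zero → a≈0 ; (suc zero) → b≈0 }))
      L⊆⟨X,Y⟩ : ∀ i → InSpan (X ∷ Y ∷ []) (L i)
      L⊆⟨X,Y⟩ zero       = proj₁ L-in-⟨X,Y⟩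
      L⊆⟨X,Y⟩ (suc zero) = proj₂ L-in-⟨X,Y⟩
      ⟨X,Y⟩⊆L : ∀ i → InSpan L ((X ∷ Y ∷ []) i)
      ⟨X,Y⟩⊆L zero       = xs , X≋
      ⟨X,Y⟩⊆L (suc zero) = Y∈L

    line-to-subspace : ∀ {m k} {Ω : Fin k → Vec m} {P ω} → ¬ InSpan Ω P → NonZeroV ω → InSpan Ω ω →
      IsLine (P ∷ ω ∷ [])
    line-to-subspace {Ω = Ω} {P} {ω} P∉Ω ω≢0 ω∈Ω =
      independent-extend {gs = ω ∷ []} (independent-extend {gs = []} (λ _ _ ()) ω∉⟨⟩) P∉⟨ω⟩
      where
      ω∉⟨⟩ : ¬ InSpan [] ω
      ω∉⟨⟩ (_ , ω≋0) = ω≢0 ω≋0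
      P∉⟨ω⟩ : ¬ InSpan (ω ∷ []) P
      P∉⟨ω⟩ P∈ = P∉Ω (span-⊆ {gs = ω ∷ []} (λ { zero → ω∈Ω }) P∈)

    same-line⇒proportional : ∀ {m k} {Ω : Fin k → Vec m} {P} → Independent Ω → ¬ InSpan Ω P →
      ∀ c d → SameLine (P ∷ lincomb c Ω ∷ []) (P ∷ lincomb d Ω ∷ []) → Proportional c d
    same-line⇒proportional {m} {Ω = Ω} {P} indΩ P∉Ω c d same = b , d≈bc
      where
      ωc ωd : Vec m
      ωc = lincomb c Ω
      ωd = lincomb d Ω
      ωd∈Pωc : InSpan (P ∷ ωc ∷ []) ωd
      ωd∈Pωc = proj₂ (same ωd) (span-gen (P ∷ ωd ∷ []) (suc zero))
      a b : Carrier
      a = proj₁ ωd∈Pωc zero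
      b = proj₁ ωd∈Pωc (suc zero)
      ωd≋ : ωd ≋ ((a ·v P) +v ((b ·v ωc) +v 0v))
      ωd≋ = proj₂ ωd∈Pωc
      bωc∈Ω : InSpan Ω ((b ·v ωc) +v 0v)
      bωc∈Ω = span-+ (span-· b (c , ≋-refl)) span-0
      a≈0 : a ≈ 0#
      a≈0 = off-subspace-coefficient a P∉Ω bωc∈Ω (span-resp ωd≋ (d , ≋-refl))
      ωd≋bωc : lincomb d Ω ≋ lincomb (λ i → b * c i) Ω
      ωd≋bωc j = begin
        ωd j                           ≈⟨ ωd≋ j ⟩
        a * P j + (b * ωc j + 0#)      ≈⟨ +-cong (trans (*-cong a≈0 refl) (zeroˡ _)) (+-identityʳ _) ⟩
        0# + b * ωc j                  ≈⟨ +-identityˡ _ ⟩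
        b * ωc j                       ≈⟨ lincomb-· b c Ω j ⟨
        lincomb (λ i → b * c i) Ω j    ∎
      d≈bc : d ≋ (b ·v c)
      d≈bc = independent-unique indΩ d (λ i → b * c i) ωd≋bωc

    nonzero? : ∀ {n} (u : Vec n) → Dec (NonZeroV u)
    nonzero? u = ¬? (all? (λ i → u i ≟ 0#))

    Dependent : ∀ {m k} → (Fin k → Vec m) → Set (c ⊔ ℓ)
    Dependent gs = ∃ λ cs → NonZeroV cs × lincomb cs gs ≋ 0v

    module Enumeration {q} (card : Bijection setoid (≡.setoid (Fin q))) where
      open Inverse (Bijection⇒Inverse card) using (to; from; to-cong; strictlyInverseˡ; strictlyInverseʳ)

      elements : List Carrier
      elements = List.tabulate from

      elements-complete : ∀ x → Any (x ≈_) elements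
      elements-complete x = Anyₚ.tabulate⁺ (to x) (sym (strictlyInverseʳ x))

      elements-distinct : AllPairs (λ a b → ¬ a ≈ b) elements
      elements-distinct = AllPairsₚ.tabulate⁺ λ {i} {j} i≢j fi≈fj →
        i≢j (≡.trans (≡.sym (strictlyInverseˡ i)) (≡.trans (to-cong fi≈fj) (strictlyInverseˡ j)))

      vectors : ∀ n → List (Vec n)
      vectors zero    = List.[ [] ]
      vectors (suc n) = List.cartesianProductWith _∷_ elements (vectors n)

      vectors-complete : ∀ {n} (v : Vec n) → Any (v ≋_) (vectors n)
      vectors-complete {zero}  v = here (λ ())
      vectors-complete {suc n} v = Anyₚ.cartesianProductWith⁺ _∷_
        (λ v₀≈x tail≋y → λ { zero → v₀≈x ; (suc i) → tail≋y i })
        (elements-complete (v zero)) (vectors-complete (v ∘ suc))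

      vectors-distinct : ∀ n → AllPairs (λ u v → ¬ u ≋ v) (vectors n)
      vectors-distinct zero    = All.[] AllPairs.∷ AllPairs.[]
      vectors-distinct (suc n) = Uniqueₚ.cartesianProductWith⁺ setoid (≋-setoid n) (≋-setoid (suc n)) _∷_
        (λ eq → eq zero , eq ∘ suc) elements-distinct (vectors-distinct n)

      vectors-length : ∀ n → length (vectors n) ≡ q ℕ.^ n
      vectors-length zero    = ≡.refl
      vectors-length (suc n) = ≡.trans (length-cartesianProductWith _∷_ elements (vectors n))
        (≡.cong₂ ℕ._*_ (Listₚ.length-tabulate from) (vectors-length n))

      ∃-decidable : ∀ {n p} (Q : Vec n → Set p) → (∀ {u v} → u ≋ v → Q u → Q v) →
        (∀ u → Dec (Q u)) → Dec (∃ Q)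
      ∃-decidable {n} Q resp Q? with Any.any? Q? (vectors n)
      ... | yes found = yes (Any.satisfied found)
      ... | no  none  = no λ (u , Qu) → none (Any.map (λ u≋v → resp u≋v Qu) (vectors-complete u))

      dependent? : ∀ {m k} (gs : Fin k → Vec m) → Dec (Dependent gs)
      dependent? gs = ∃-decidable _ resp (λ cs → nonzero? cs ×-dec all? (λ j → lincomb cs gs j ≟ 0#))
        where
        resp : ∀ {cs ds} → cs ≋ ds → NonZeroV cs × lincomb cs gs ≋ 0v → NonZeroV ds × lincomb ds gs ≋ 0v
        resp cs≋ds (cs≢0 , comb≋0) =
          (λ ds≋0 → cs≢0 (≋-trans cs≋ds ds≋0)) , ≋-trans (lincomb-cong gs (λ i → sym (cs≋ds i))) comb≋0

      independent-or-dependent : ∀ {m k} (gs : Fin k → Vec m) → Independent gs ⊎ Dependent gs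
      independent-or-dependent gs with dependent? gs
      ... | yes dependent  = inj₂ dependent
      ... | no  ¬dependent = inj₁ λ cs comb≋0 →
        decidable-stable (all? (λ i → cs i ≟ 0#)) (λ cs≢0 → ¬dependent (cs , cs≢0 , comb≋0))

      -- Normalised representatives of the points of PG(n−1, q): nonzero vectors whose first
      -- nonzero coordinate is 1.
      points : ∀ n → List (Vec n)
      points zero    = List.[]
      points (suc n) = List.map (1# ∷_) (vectors n) List.++ List.map (0# ∷_) (points n)

      points-nonzero : ∀ n → All NonZeroV (points n)
      points-nonzero zero    = All.[]
      points-nonzero (suc n) = Allₚ.++⁺
        (Allₚ.map⁺ (All.universal (λ _ v≋0 → 1≉0 (v≋0 zero)) (vectors n)))
        (Allₚ.map⁺ (All.map (λ v≢0 v≋0 → v≢0 (v≋0 ∘ suc)) (points-nonzero n)))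

      points-distinct : ∀ n → AllPairs (λ u v → ¬ Proportional u v) (points n)
      points-distinct zero    = AllPairs.[]
      points-distinct (suc n) = AllPairsₚ.++⁺
        (AllPairsₚ.map⁺ (AllPairs.map leading-one (vectors-distinct n)))
        (AllPairsₚ.map⁺ (AllPairs.map leading-zero (points-distinct n)))
        (Allₚ.map⁺ (All.universal (λ u → Allₚ.map⁺ (All.map (mixed u) (points-nonzero n))) (vectors n)))
        where
        leading-one : ∀ {u v} → ¬ u ≋ v → ¬ Proportional (1# ∷ u) (1# ∷ v)
        leading-one u≉v (b , 1v≋b1u) =
          u≉v λ i → sym (trans (1v≋b1u (suc i)) (trans (*-cong b≈1 refl) (*-identityˡ _)))
          where
          b≈1 : b ≈ 1#
          b≈1 = trans (sym (*-identityʳ b)) (sym (1v≋b1u zero))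
        leading-zero : ∀ {u v} → ¬ Proportional u v → ¬ Proportional (0# ∷ u) (0# ∷ v)
        leading-zero u≁v (b , 0v≋b0u) = u≁v (b , 0v≋b0u ∘ suc)
        mixed : ∀ u {v} → NonZeroV v → ¬ Proportional (1# ∷ u) (0# ∷ v)
        mixed u v≢0 (b , 0v≋b1u) = v≢0 λ i → trans (0v≋b1u (suc i)) (trans (*-cong b≈0 refl) (zeroˡ _))
          where
          b≈0 : b ≈ 0#
          b≈0 = trans (sym (*-identityʳ b)) (sym (0v≋b1u zero))

      points-cover : ∀ n d → NonZeroV d → Any (λ c → NonZeroV c × Proportional d c) (points n)
      points-cover zero    d d≢0 = ⊥-elim (d≢0 (λ ()))
      points-cover (suc n) d d≢0 with d zero ≟ 0#
      ... | no d₀≉0 = Anyₚ.++⁺ˡ (Anyₚ.map⁺ (Any.map scaled (vectors-complete (λ i → d₀⁻¹ * d (suc i)))))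
        where
        d₀⁻¹ : Carrier
        d₀⁻¹ = proj₁ (inverse (d zero) d₀≉0)
        scaled : ∀ {u} → (λ i → d₀⁻¹ * d (suc i)) ≋ u → NonZeroV (1# ∷ u) × Proportional d (1# ∷ u)
        scaled u≋ = (λ 1u≋0 → 1≉0 (1u≋0 zero)) , d₀⁻¹ , λ where
          zero    → trans (sym (proj₂ (inverse (d zero) d₀≉0))) (*-comm _ _)
          (suc i) → sym (u≋ i)
      ... | yes d₀≈0 = Anyₚ.++⁺ʳ _ (Anyₚ.map⁺ (Any.map shifted (points-cover n (d ∘ suc) tail≢0)))
        where
        tail≢0 : NonZeroV (d ∘ suc)
        tail≢0 tail≋0 = d≢0 λ { zero → d₀≈0 ; (suc i) → tail≋0 i }
        shifted : ∀ {c} → NonZeroV c × Proportional (d ∘ suc) c →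
          NonZeroV (0# ∷ c) × Proportional d (0# ∷ c)
        shifted (c≢0 , b , c≋) = (λ 0c≋0 → c≢0 (0c≋0 ∘ suc)) , b , λ where
          zero    → sym (trans (*-cong refl d₀≈0) (zeroʳ b))
          (suc i) → c≋ i

      points-count : ∀ n → length (points n) ℕ.* (q ℕ.∸ 1) ≡ q ℕ.^ n ℕ.∸ 1
      points-count zero    = ≡.refl
      points-count (suc n) = ≡.subst (λ len → len ℕ.* (q ℕ.∸ 1) ≡ q ℕ.^ suc n ℕ.∸ 1) (≡.sym points-length)
                                     (geometric-step q n _ (points-count n))
        where
        points-length : length (points (suc n)) ≡ q ℕ.^ n ℕ.+ length (points n)
        points-length = ≡.trans (Listₚ.length-++ (List.map (1# ∷_) (vectors n)))
          (≡.cong₂ ℕ._+_ (≡.trans (Listₚ.length-map _ (vectors n)) (vectors-length n))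
                         (Listₚ.length-map _ (points n)))

    module Cone {m k} (Ω : Fin k → Vec m) (Γ : Fin 3 → Vec m) (disjoint : Disjoint Ω Γ)
                (B : PointSet m) (B⊆Γ : PointSetOf Γ B) where

      base-in-plane : ∀ {w} → w ∈P B → InSpan Γ w
      base-in-plane {w} (_ , w∈B) = All.lookupWith {R = λ _ → InSpan Γ w}
        (λ (_ , b∈Γ) (a , w≋ab) → span-resp {gs = Γ} (≋-sym w≋ab) (span-· {gs = Γ} a b∈Γ)) B⊆Γ w∈B

      cone-decompose : ∀ {x} → InCone Ω B x → ∃ λ w → w ∈P B × ∃ λ e → x ≡[ Ω ] (e ·v w)
      cone-decompose (_ , w , w∈B , cs , x≋) =
        w , w∈B , cs zero , cs ∘ suc , λ j → trans (+-cong (x≋ j) refl) (xyx⁻¹≈y _ _)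

      projection-in-base : ∀ {x v} → InCone Ω B x → InSpan Γ v → NonZeroV v → x ≡[ Ω ] v → v ∈P B
      projection-in-base {v = v} x∈K v∈Γ v≢0 x≡v with cone-decompose x∈K
      ... | w , (w≢0 , w∈B) , e , x≡ew = v≢0 , Any.map (λ {b} (a , w≋ab) → e * a , v≋[ea]b w≋ab) w∈B
        where
        v≋ew : v ≋ (e ·v w)
        v≋ew = ≡-disjoint {T = Γ} disjoint (≡-trans (≡-sym x≡v) x≡ew) v∈Γ
                          (span-· {gs = Γ} e (base-in-plane (w≢0 , w∈B)))
        v≋[ea]b : ∀ {a b} → w ≋ (a ·v b) → v ≋ ((e * a) ·v b)
        v≋[ea]b {a} {b} w≋ab j = trans (v≋ew j) (trans (*-cong refl (w≋ab j)) (sym (*-assoc e a (b j))))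

      join-in-cone : ∀ {P ω} → InCone Ω B P → InSpan Ω ω → IsLine (P ∷ ω ∷ []) → LineInCone Ω B (P ∷ ω ∷ [])
      join-in-cone {P} {ω} (_ , w , w∈B , P∈⟨w,Ω⟩) ω∈Ω ind = ind , λ v (v≢0 , v∈⟨P,ω⟩) →
        v≢0 , w , w∈B , span-⊆ {gs = P ∷ ω ∷ []} {hs = w ∷ Ω}
                          (λ { zero → P∈⟨w,Ω⟩ ; (suc zero) → span-tail w ω∈Ω }) v∈⟨P,ω⟩

      project-line : ∀ L → LineInCone Ω B L →
        ∃ λ (M : Line m) → (∀ i → L i ≡[ Ω ] M i) × (∀ i → InSpan Γ (M i))
      project-line L (indL , L⊆K) = M , L≡M , M⊆Γ
        where
        decomposition : ∀ i → ∃ λ w → w ∈P B × ∃ λ e → L i ≡[ Ω ] (e ·v w)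
        decomposition i = cone-decompose (L⊆K (L i) (independent⇒nonzero {gs = L} indL i , span-gen L i))
        M : Line m
        M i = proj₁ (proj₂ (proj₂ (decomposition i))) ·v proj₁ (decomposition i)
        L≡M : ∀ i → L i ≡[ Ω ] M i
        L≡M i = proj₂ (proj₂ (proj₂ (decomposition i)))
        M⊆Γ : ∀ i → InSpan Γ (M i)
        M⊆Γ i = span-· {gs = Γ} _ (base-in-plane (proj₁ (proj₂ (decomposition i))))

      projected-line-in-base : ∀ L → LineInCone Ω B L → (M : Line m) → (∀ i → L i ≡[ Ω ] M i) →
        (∀ i → InSpan Γ (M i)) → ∀ v → PointIn M v → v ∈P B
      projected-line-in-base L (_ , L⊆K) M L≡M M⊆Γ v (v≢0 , cs , v≋) = projection-in-base x∈K v∈Γ v≢0 x≡v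
        where
        x : Vec m
        x = lincomb cs L
        x≡v : x ≡[ Ω ] v
        x≡v = ≡-resp (≡-lincomb L≡M cs) (≋-sym v≋)
        v∈Γ : InSpan Γ v
        v∈Γ = span-⊆ {gs = M} {hs = Γ} M⊆Γ (cs , v≋)
        x≢0 : NonZeroV x
        x≢0 x≋0 = v≢0 (disjoint v (≡-0 (≡-sym x≡v) x≋0) v∈Γ)
        x∈K : InCone Ω B x
        x∈K = L⊆K x (x≢0 , cs , ≋-refl)

      dependent-projection⇒meets-vertex : ∀ L → IsLine L → (M : Line m) → (∀ i → L i ≡[ Ω ] M i) →
        Dependent M → ∃ λ d → NonZeroV d × InSpan L (lincomb d Ω)
      dependent-projection⇒meets-vertex L indL M L≡M (cs , cs≢0 , Mcomb≋0) =
        proj₁ ω∈Ω , d≢0 , cs , ≋-sym (proj₂ ω∈Ω)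
        where
        ω∈Ω : InSpan Ω (lincomb cs L)
        ω∈Ω = ≡-0 (≡-lincomb L≡M cs) Mcomb≋0
        d≢0 : NonZeroV (proj₁ ω∈Ω)
        d≢0 d≋0 = cs≢0 (indL cs (≋-trans (proj₂ ω∈Ω) (lincomb-zero Ω d≋0)))

      line-meets-vertex : NonTrivial Γ B → (∀ (M : Line m) → Independent M ⊎ Dependent M) →
        ∀ L → LineInCone Ω B L → ∃ λ d → NonZeroV d × InSpan L (lincomb d Ω)
      line-meets-vertex nontrivial dichotomy L L⊆K with project-line L L⊆K
      ... | M , L≡M , M⊆Γ with dichotomy M
      ...   | inj₁ indM = ⊥-elim (nontrivial M (indM , M⊆Γ) (projected-line-in-base L L⊆K M L≡M M⊆Γ))
      ...   | inj₂ dep  = dependent-projection⇒meets-vertex L (proj₁ L⊆K) M L≡M dep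

      module LinesThrough (indΩ : Independent Ω) {P} (P∈K : InCone Ω B P) (P∉Ω : ¬ InSpan Ω P) where

        join : Vec k → Line m
        join c = P ∷ lincomb c Ω ∷ []

        join-is-line : ∀ {c} → NonZeroV c → IsLine (join c)
        join-is-line {c} c≢0 = line-to-subspace P∉Ω (λ ω≋0 → c≢0 (indΩ c ω≋0)) (c , ≋-refl)

        join-through-P : ∀ {c} → NonZeroV c → LineInCone Ω B (join c) × InSpan (join c) P
        join-through-P {c} c≢0 = join-in-cone P∈K (c , ≋-refl) (join-is-line c≢0) , span-gen (join c) zero

        join-injective : ∀ c d → SameLine (join c) (join d) → Proportional c d
        join-injective = same-line⇒proportional indΩ P∉Ω

        join-complete : ∀ L {c d} → IsLine (join c) → InSpan L P → InSpan L (lincomb d Ω) →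
          Proportional d c → SameLine L (join c)
        join-complete L {c} {d} join-line P∈L ωd∈L (b , c≋bd) = line-spanned-by L join-line P∈L ωc∈L
          where
          ωc∈L : InSpan L (lincomb c Ω)
          ωc∈L = span-resp {gs = L} (≋-sym (≋-trans (lincomb-cong Ω c≋bd) (lincomb-· b d Ω)))
                                    (span-· {gs = L} b ωd∈L)

open import Data.Nat using (ℕ; _≤_; _∸_; _*_; _^_)

lemma11 : ∀ {c ℓ} (F : CommutativeRing c ℓ) (q : ℕ) → IsPrimePower q → IsFiniteField F q →
    (t : ℕ) → 1 ≤ t → (m : ℕ) →
    let open Geometry F in
    (Ω : Fin (t ∸ 1) → Vec m) → Independent Ω →
    (Γ : Fin 3 → Vec m) → Independent Γ → Disjoint Ω Γ →
    (B : PointSet m) → PointSetOf Γ B → Blocking Γ B → Minimal Γ B → NonTrivial Γ B →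
    (P : Vec m) → InCone Ω B P → ¬ InSpan Ω P →
    ∃ λ (Ls : List (Line m)) →
      All (λ L → LineInCone Ω B L × InSpan L P) Ls ×
      AllPairs (λ L L′ → ¬ SameLine L L′) Ls ×
      (∀ L → LineInCone Ω B L → InSpan L P → Any (SameLine L) Ls) ×
      length Ls * (q ∸ 1) ≡ q ^ (t ∸ 1) ∸ 1
lemma11 F q _ isF t _ m Ω indΩ Γ _ disjoint B B⊆Γ _ _ nontrivial P P∈K P∉Ω =
  List.map join (points n) ,
  Allₚ.map⁺ (All.map join-through-P (points-nonzero n)) ,
  AllPairsₚ.map⁺ (AllPairs.map (λ {c} {d} c≁d same → c≁d (join-injective c d same)) (points-distinct n)) ,
  all-lines-are-joins ,
  ≡.trans (≡.cong (_* (q ∸ 1)) (Listₚ.length-map join (points n))) (points-count n)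
  where
  open Geometry F
  open LinearAlgebra F
  open IsFiniteField isF
  open DiscreteField _≟_ 0≉1 inverse
  open Enumeration card
  open Cone Ω Γ disjoint B B⊆Γ
  open LinesThrough indΩ P∈K P∉Ω

  n : ℕ
  n = t ∸ 1

  -- A line of K through P meets ⟨Ω⟩ in a point d, whose normalised representative c gives its join.
  all-lines-are-joins : ∀ L → LineInCone Ω B L → InSpan L P → Any (SameLine L) (List.map join (points n))
  all-lines-are-joins L L⊆K P∈L with line-meets-vertex nontrivial independent-or-dependent L L⊆K
  ... | d , d≢0 , ωd∈L = Anyₚ.map⁺ (Any.map
    (λ (c≢0 , d∝c) → join-complete L (join-is-line c≢0) P∈L ωd∈L d∝c) (points-cover n d d≢0))
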